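{- Let $\mathcal{M}^{\le\ge}$ be the set of Dyck paths whose sequence of peak heights (read left to right) is weakly unimodal. Then, writing $[i]_z=1+z+\dots+z^{i-1}$ and $|D|$ for the semilength, $$\sum_{D\in\mathcal{M}^{\le\ge}}z^{|D|}=1+\sum_{a\ge1}\frac{z^a}{1-z[a]_z}\prod_{i=1}^{a-1}\left(\frac{1}{1-z[i]_z}\right)^2.$$
   Context: A Dyck path of semilength $n$ is a lattice path with steps $\mathbf{u}=(1,1)$ and $\mathbf{d}=(1,-1)$ from $(0,0)$ to $(2n,0)$ never going below the $x$-axis. A peak is an occurrence of consecutive steps $\mathbf{ud}$; its height is the $y$-coordinate of its highest vertex. A sequence $a_1,\dots,a_k$ is weakly unimodal if there is $j$ with $1\le j\le k$ and $a_1\le\dots\le a_j\ge a_{j+1}\ge\dots\ge a_k$; the empty path is included. -}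

module Defs where

open import Data.Nat using (ℕ; zero; suc; _+_; _*_; _∸_; _≤ᵇ_; _<ᵇ_)
open import Data.Bool using (Bool; true; false; _∧_; _∨_; if_then_else_)
open import Data.List using (List; []; _∷_; length; filter; map; upTo; take; drop; zipWith; concatMap; null)
open import Data.Nat.ListAction using (sum)
open import Data.Bool.ListAction using (any)
open import Relation.Nullary.Decidable using (does)
open import Relation.Binary.PropositionalEquality using (_≡_; refl)
open import Data.Bool.Properties using (T?)

data Step : Set where
  u d : Step

words : ℕ → List (List Step)
words zero    = [] ∷ []
words (suc k) = concatMap (λ w → (u ∷ w) ∷ (d ∷ w) ∷ []) (words k)

isDyckFrom : ℕ → List Step → Bool
isDyckFrom zero    []      = true
isDyckFrom (suc _) []      = false
isDyckFrom h       (u ∷ w) = isDyckFrom (suc h) w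
isDyckFrom zero    (d ∷ w) = false
isDyckFrom (suc h) (d ∷ w) = isDyckFrom h w

isDyck : List Step → Bool
isDyck = isDyckFrom zero

peaksFrom : ℕ → List Step → List ℕ
peaksFrom h []            = []
peaksFrom h (u ∷ d ∷ w)   = suc h ∷ peaksFrom h w
peaksFrom h (u ∷ u ∷ w)   = peaksFrom (suc h) (u ∷ w)
peaksFrom h (u ∷ [])      = []
peaksFrom h (d ∷ w)       = peaksFrom (h ∸ 1) w

peakHeights : List Step → List ℕ
peakHeights = peaksFrom zero

nondec : List ℕ → Bool
nondec []           = true
nondec (x ∷ [])     = true
nondec (x ∷ y ∷ xs) = (x ≤ᵇ y) ∧ nondec (y ∷ xs)

noninc : List ℕ → Bool
noninc []           = true
noninc (x ∷ [])     = true
noninc (x ∷ y ∷ xs) = (y ≤ᵇ x) ∧ noninc (y ∷ xs)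

weaklyUnimodal : List ℕ → Bool
weaklyUnimodal xs =
  null xs ∨ any (λ i → nondec (take (suc i) xs) ∧ noninc (drop i xs)) (upTo (length xs))
  -- i = j - 1 ranges over 0 … k-1

countM : ℕ → ℕ
countM n = length (filter (λ w → T? (isDyck w ∧ weaklyUnimodal (peakHeights w))) (words (2 * n)))

Series : Set
Series = ℕ → ℕ

one : Series
one zero    = 1
one (suc _) = 0

_⊕_ : Series → Series → Series
(f ⊕ g) n = f n + g n

_⊗_ : Series → Series → Series
(f ⊗ g) n = sum (map (λ k → f k * g (n ∸ k)) (upTo (suc n)))

zpow* : ℕ → Series → Series
zpow* a f n = if a ≤ᵇ n then f (n ∸ a) else 0

qint : ℕ → Series
qint i k = if k <ᵇ i then 1 else 0

-- 1/(1 - f) for f with zero constant term: the unique g with g = 1 + f·g,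
-- i.e. g 0 = 1, g n = Σ_{k=1}^{n} f k · g (n-k).
-- invList f n = [g n, g (n-1), …, g 0]
invList : Series → ℕ → List ℕ
invList f zero    = 1 ∷ []
invList f (suc n) =
  let prev = invList f n in
  sum (zipWith _*_ (map (λ i → f (suc i)) (upTo (suc n))) prev) ∷ prev

headℕ : List ℕ → ℕ
headℕ []      = 0
headℕ (x ∷ _) = x

inv1m : Series → Series
inv1m f n = headℕ (invList f n)

prodS : (ℕ → Series) → ℕ → Series
prodS F zero    = one
prodS F (suc m) = prodS F m ⊗ F (suc m)

term : ℕ → Series
term a = zpow* a (inv1m (zpow* 1 (qint a)) ⊗
                  prodS (λ i → inv1m (zpow* 1 (qint i)) ⊗ inv1m (zpow* 1 (qint i))) (a ∸ 1))

rhsPartial : ℕ → Series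
rhsPartial zero    = one
rhsPartial (suc N) = rhsPartial N ⊕ term (suc N)

module Submission where

-- A word in u/d is a Dyck path with weakly unimodal peak heights iff it is accepted by an automaton
-- whose states remember the current height, the height of the previous peak and whether the peak
-- sequence is still rising or already falling. Counting accepted words by semilength turns the
-- automaton into a linear system for the generating functions of its states. Let T q count the
-- falling continuations from height q with all peaks at most q, and K q the rising continuations
-- from height q + 1 right after an up step. Raising a peak bound from q to q + 1 only adds the paths
-- that first climb to q + 1, and this gives
--   T (q + 1) = T q + z [q + 1]_z T (q + 1)   and   K q = T q + z K (q + 1) + z [q + 1]_z K q,
-- so T q = Π_{i ≤ q} 1/(1 - z [i]_z) and K q = (T q + z K (q + 1))/(1 - z [q + 1]_z). The series
-- sought is 1 + z K 0, and unrolling the recursion for K N times writes it as the first N summands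
-- of the right-hand side plus z^{N+1} T N K N.

open import Defs
open import Algebra.Bundles using (CommutativeSemigroup)
import Algebra.Properties.CommutativeSemigroup as CommutativeSemigroupProperties
open import Data.Bool using (Bool; true; false; _∧_; _∨_; if_then_else_)
open import Data.Bool.ListAction using (or)
open import Data.Bool.Properties using (T-≡; T?; ∨-identityʳ; ∧-zeroʳ)
open import Data.List
  using (List; []; _∷_; length; filter; map; upTo; applyUpTo; applyDownFrom; reverse; take; drop; zipWith; concatMap)
open import Data.List.Properties using (map-upTo; reverse-applyUpTo)
open import Data.List.Relation.Binary.Permutation.Propositional.Properties using (↭-reverse)
open import Data.Nat using (ℕ; zero; suc; _+_; _*_; _∸_; _≤_; _<_; z≤n; s≤s; _≤ᵇ_)
open import Data.Nat.ListAction using (sum)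
open import Data.Nat.ListAction.Properties using (sum-↭)
open import Data.Nat.Properties
open import Data.Nat.Tactic.RingSolver using (solve-∀)
open import Data.Sum using (inj₁; inj₂)
open import Function.Bundles using (Equivalence)
open import Relation.Binary.Bundles using (Setoid)
import Relation.Binary.Reasoning.Setoid as SetoidReasoning
open import Relation.Binary.PropositionalEquality
open import Relation.Nullary using (contradiction)

module +-Properties = CommutativeSemigroupProperties +-commutativeSemigroup

Σ< : ℕ → (ℕ → ℕ) → ℕ
Σ< n f = sum (applyUpTo f n)

Σ<-cong : ∀ n {f g : ℕ → ℕ} → (∀ {k} → k < n → f k ≡ g k) → Σ< n f ≡ Σ< n g
Σ<-cong zero    f≡g = refl
Σ<-cong (suc n) f≡g = cong₂ _+_ (f≡g (s≤s z≤n)) (Σ<-cong n (λ k<n → f≡g (s≤s k<n)))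

Σ<-zero : ∀ n → Σ< n (λ _ → 0) ≡ 0
Σ<-zero zero    = refl
Σ<-zero (suc n) = Σ<-zero n

Σ<-distrib-+ : ∀ n (f g : ℕ → ℕ) → Σ< n (λ k → f k + g k) ≡ Σ< n f + Σ< n g
Σ<-distrib-+ zero    f g = refl
Σ<-distrib-+ (suc n) f g = begin
  (f 0 + g 0) + Σ< n (λ k → f (suc k) + g (suc k))
    ≡⟨ cong ((f 0 + g 0) +_) (Σ<-distrib-+ n (λ k → f (suc k)) (λ k → g (suc k))) ⟩
  (f 0 + g 0) + (Σ< n (λ k → f (suc k)) + Σ< n (λ k → g (suc k)))
    ≡⟨ +-Properties.interchange (f 0) (g 0) _ _ ⟩
  (f 0 + Σ< n (λ k → f (suc k))) + (g 0 + Σ< n (λ k → g (suc k)))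
    ∎
  where open ≡-Reasoning

*-distribˡ-Σ< : ∀ n c (f : ℕ → ℕ) → c * Σ< n f ≡ Σ< n (λ k → c * f k)
*-distribˡ-Σ< zero    c f = *-zeroʳ c
*-distribˡ-Σ< (suc n) c f =
  trans (*-distribˡ-+ c (f 0) _) (cong (c * f 0 +_) (*-distribˡ-Σ< n c (λ k → f (suc k))))

applyDownFrom≡applyUpTo : ∀ (f : ℕ → ℕ) n → applyDownFrom f n ≡ applyUpTo (λ k → f (n ∸ suc k)) n
applyDownFrom≡applyUpTo f zero    = refl
applyDownFrom≡applyUpTo f (suc n) = cong (f n ∷_) (applyDownFrom≡applyUpTo f n)

Σ<-reverse : ∀ n (f : ℕ → ℕ) → Σ< n f ≡ Σ< n (λ k → f (n ∸ suc k))
Σ<-reverse n f = begin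
  sum (applyUpTo f n)                      ≡⟨ sum-↭ (↭-reverse (applyUpTo f n)) ⟨
  sum (reverse (applyUpTo f n))            ≡⟨ cong sum (reverse-applyUpTo f n) ⟩
  sum (applyDownFrom f n)                  ≡⟨ cong sum (applyDownFrom≡applyUpTo f n) ⟩
  sum (applyUpTo (λ k → f (n ∸ suc k)) n)  ∎
  where open ≡-Reasoning

infix 4 _≈_
record _≈_ (f g : Series) : Set where
  constructor mk≈
  field at : ∀ n → f n ≡ g n
open _≈_ public

≈-setoid : Setoid _ _
≈-setoid = record
  { Carrier = Series
  ; _≈_ = _≈_
  ; isEquivalence = record
    { refl = mk≈ λ _ → refl
    ; sym = λ f≈g → mk≈ λ n → sym (at f≈g n)
    ; trans = λ f≈g g≈h → mk≈ λ n → trans (at f≈g n) (at g≈h n)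
    }
  }

open Setoid ≈-setoid public using () renaming (refl to ≈-refl; sym to ≈-sym; trans to ≈-trans)

module ≈-Reasoning = SetoidReasoning ≈-setoid

zeroS : Series
zeroS _ = 0

z* : Series → Series
z* = zpow* 1

⊕-cong : ∀ {f f′ g g′} → f ≈ f′ → g ≈ g′ → f ⊕ g ≈ f′ ⊕ g′
⊕-cong f≈f′ g≈g′ = mk≈ λ n → cong₂ _+_ (at f≈f′ n) (at g≈g′ n)

⊕-congˡ : ∀ f {g g′} → g ≈ g′ → f ⊕ g ≈ f ⊕ g′
⊕-congˡ f = ⊕-cong (≈-refl {f})

⊕-congʳ : ∀ {f f′} g → f ≈ f′ → f ⊕ g ≈ f′ ⊕ g
⊕-congʳ g f≈f′ = ⊕-cong f≈f′ (≈-refl {g})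

⊕-comm : ∀ f g → f ⊕ g ≈ g ⊕ f
⊕-comm f g = mk≈ λ n → +-comm (f n) (g n)

⊕-assoc : ∀ f g h → (f ⊕ g) ⊕ h ≈ f ⊕ (g ⊕ h)
⊕-assoc f g h = mk≈ λ n → +-assoc (f n) (g n) (h n)

⊕-vanishʳ : ∀ f {g} → g ≈ zeroS → f ⊕ g ≈ f
⊕-vanishʳ f g≈0 = mk≈ λ n → trans (cong (f n +_) (at g≈0 n)) (+-identityʳ (f n))

⊕-commutativeSemigroup : CommutativeSemigroup _ _
⊕-commutativeSemigroup = record
  { Carrier = Series
  ; _≈_ = _≈_
  ; _∙_ = _⊕_
  ; isCommutativeSemigroup = record
    { isSemigroup = record
      { isMagma = record { isEquivalence = Setoid.isEquivalence ≈-setoid ; ∙-cong = ⊕-cong }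
      ; assoc = ⊕-assoc
      }
    ; comm = ⊕-comm
    }
  }

module ⊕-Properties = CommutativeSemigroupProperties ⊕-commutativeSemigroup

z*-cong : ∀ {f g} → f ≈ g → z* f ≈ z* g
z*-cong f≈g = mk≈ λ where
  zero    → refl
  (suc n) → at f≈g n

z*-zero : ∀ {f} → f ≈ zeroS → z* f ≈ zeroS
z*-zero f≈0 = mk≈ λ where
  zero    → refl
  (suc n) → at f≈0 n

z*-⊕ : ∀ f g → z* (f ⊕ g) ≈ z* f ⊕ z* g
z*-⊕ f g = mk≈ λ where
  zero    → refl
  (suc n) → refl

⊗-unfold : ∀ f g n → (f ⊗ g) n ≡ Σ< (suc n) (λ k → f k * g (n ∸ k))
⊗-unfold f g n = cong sum (map-upTo (λ k → f k * g (n ∸ k)) (suc n))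

⊗-cong-≤ : ∀ {f f′ g g′} n → (∀ {k} → k ≤ n → f k ≡ f′ k) → (∀ {k} → k ≤ n → g k ≡ g′ k) →
           (f ⊗ g) n ≡ (f′ ⊗ g′) n
⊗-cong-≤ {f} {f′} {g} {g′} n f≡f′ g≡g′ = begin
  (f ⊗ g) n                             ≡⟨ ⊗-unfold f g n ⟩
  Σ< (suc n) (λ k → f k * g (n ∸ k))    ≡⟨ Σ<-cong (suc n) (λ {k} k<1+n →
                                             cong₂ _*_ (f≡f′ (≤-pred k<1+n)) (g≡g′ (m∸n≤m n k))) ⟩
  Σ< (suc n) (λ k → f′ k * g′ (n ∸ k))  ≡⟨ ⊗-unfold f′ g′ n ⟨
  (f′ ⊗ g′) n                           ∎
  where open ≡-Reasoning

⊗-cong : ∀ {f f′ g g′} → f ≈ f′ → g ≈ g′ → f ⊗ g ≈ f′ ⊗ g′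
⊗-cong f≈f′ g≈g′ = mk≈ λ n → ⊗-cong-≤ n (λ {k} _ → at f≈f′ k) (λ {k} _ → at g≈g′ k)

⊗-congˡ : ∀ f {g g′} → g ≈ g′ → f ⊗ g ≈ f ⊗ g′
⊗-congˡ f = ⊗-cong (≈-refl {f})

⊗-congʳ : ∀ {f f′} g → f ≈ f′ → f ⊗ g ≈ f′ ⊗ g
⊗-congʳ g f≈f′ = ⊗-cong f≈f′ (≈-refl {g})

⊗-comm : ∀ f g → f ⊗ g ≈ g ⊗ f
⊗-comm f g = mk≈ λ n → begin
  (f ⊗ g) n                                        ≡⟨ ⊗-unfold f g n ⟩
  Σ< (suc n) (λ k → f k * g (n ∸ k))               ≡⟨ Σ<-reverse (suc n) (λ k → f k * g (n ∸ k)) ⟩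
  Σ< (suc n) (λ k → f (n ∸ k) * g (n ∸ (n ∸ k)))   ≡⟨ Σ<-cong (suc n) (λ {k} k<1+n →
      trans (cong (λ i → f (n ∸ k) * g i) (m∸[m∸n]≡n (≤-pred k<1+n))) (*-comm (f (n ∸ k)) (g k))) ⟩
  Σ< (suc n) (λ k → g k * f (n ∸ k))               ≡⟨ ⊗-unfold g f n ⟨
  (g ⊗ f) n                                        ∎
  where open ≡-Reasoning

⊗-identityˡ : ∀ f → one ⊗ f ≈ f
⊗-identityˡ f = mk≈ λ n → begin
  (one ⊗ f) n                 ≡⟨ ⊗-unfold one f n ⟩
  1 * f n + Σ< n (λ _ → 0)    ≡⟨ cong₂ _+_ (*-identityˡ (f n)) (Σ<-zero n) ⟩
  f n + 0                     ≡⟨ +-identityʳ (f n) ⟩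
  f n                         ∎
  where open ≡-Reasoning

⊗-distribʳ-⊕ : ∀ h f g → (f ⊕ g) ⊗ h ≈ (f ⊗ h) ⊕ (g ⊗ h)
⊗-distribʳ-⊕ h f g = mk≈ λ n → begin
  ((f ⊕ g) ⊗ h) n
    ≡⟨ ⊗-unfold (f ⊕ g) h n ⟩
  Σ< (suc n) (λ k → (f k + g k) * h (n ∸ k))
    ≡⟨ Σ<-cong (suc n) (λ {k} _ → *-distribʳ-+ (h (n ∸ k)) (f k) (g k)) ⟩
  Σ< (suc n) (λ k → f k * h (n ∸ k) + g k * h (n ∸ k))
    ≡⟨ Σ<-distrib-+ (suc n) (λ k → f k * h (n ∸ k)) (λ k → g k * h (n ∸ k)) ⟩
  Σ< (suc n) (λ k → f k * h (n ∸ k)) + Σ< (suc n) (λ k → g k * h (n ∸ k))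
    ≡⟨ cong₂ _+_ (⊗-unfold f h n) (⊗-unfold g h n) ⟨
  ((f ⊗ h) ⊕ (g ⊗ h)) n
    ∎
  where open ≡-Reasoning

⊗-distribˡ-⊕ : ∀ h f g → h ⊗ (f ⊕ g) ≈ (h ⊗ f) ⊕ (h ⊗ g)
⊗-distribˡ-⊕ h f g = begin
  h ⊗ (f ⊕ g)          ≈⟨ ⊗-comm h (f ⊕ g) ⟩
  (f ⊕ g) ⊗ h          ≈⟨ ⊗-distribʳ-⊕ h f g ⟩
  (f ⊗ h) ⊕ (g ⊗ h)    ≈⟨ ⊕-cong (⊗-comm f h) (⊗-comm g h) ⟩
  (h ⊗ f) ⊕ (h ⊗ g)    ∎
  where open ≈-Reasoning

⊗-scaleˡ : ∀ c g h → (λ n → c * g n) ⊗ h ≈ (λ n → c * (g ⊗ h) n)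
⊗-scaleˡ c g h = mk≈ λ n → begin
  ((λ n → c * g n) ⊗ h) n                    ≡⟨ ⊗-unfold (λ n → c * g n) h n ⟩
  Σ< (suc n) (λ k → c * g k * h (n ∸ k))     ≡⟨ Σ<-cong (suc n) (λ {k} _ → *-assoc c (g k) (h (n ∸ k))) ⟩
  Σ< (suc n) (λ k → c * (g k * h (n ∸ k)))   ≡⟨ *-distribˡ-Σ< (suc n) c (λ k → g k * h (n ∸ k)) ⟨
  c * Σ< (suc n) (λ k → g k * h (n ∸ k))     ≡⟨ cong (c *_) (⊗-unfold g h n) ⟨
  c * (g ⊗ h) n                              ∎
  where open ≡-Reasoning

z*-⊗ : ∀ f g → z* f ⊗ g ≈ z* (f ⊗ g)
z*-⊗ f g = mk≈ λ where
  zero    → refl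
  (suc n) → trans (⊗-unfold (z* f) g (suc n)) (sym (⊗-unfold f g n))

tail : Series → Series
tail f n = f (suc n)

⊗-unfold-head : ∀ f g → f ⊗ g ≈ (λ n → f 0 * g n) ⊕ z* (tail f ⊗ g)
⊗-unfold-head f g = mk≈ λ where
  zero    → ⊗-unfold f g 0
  (suc n) → trans (⊗-unfold f g (suc n)) (cong (f 0 * g (suc n) +_) (sym (⊗-unfold (tail f) g n)))

-- Induction on the coefficient index, splitting off the constant term of f each time.
⊗-assoc : ∀ f g h → (f ⊗ g) ⊗ h ≈ f ⊗ (g ⊗ h)
⊗-assoc f g h = mk≈ (λ n → assoc n f)
  where
  assoc : ∀ n f → ((f ⊗ g) ⊗ h) n ≡ (f ⊗ (g ⊗ h)) n
  shifted : ∀ n f → z* ((tail f ⊗ g) ⊗ h) n ≡ z* (tail f ⊗ (g ⊗ h)) n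
  shifted zero    f = refl
  shifted (suc n) f = assoc n (tail f)
  assoc n f = begin
    ((f ⊗ g) ⊗ h) n
      ≡⟨ at (⊗-congʳ h (⊗-unfold-head f g)) n ⟩
    (((λ n → f 0 * g n) ⊕ z* (tail f ⊗ g)) ⊗ h) n
      ≡⟨ at (⊗-distribʳ-⊕ h (λ n → f 0 * g n) (z* (tail f ⊗ g))) n ⟩
    ((λ n → f 0 * g n) ⊗ h) n + (z* (tail f ⊗ g) ⊗ h) n
      ≡⟨ cong₂ _+_ (at (⊗-scaleˡ (f 0) g h) n) (at (z*-⊗ (tail f ⊗ g) h) n) ⟩
    f 0 * (g ⊗ h) n + z* ((tail f ⊗ g) ⊗ h) n
      ≡⟨ cong (f 0 * (g ⊗ h) n +_) (shifted n f) ⟩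
    f 0 * (g ⊗ h) n + z* (tail f ⊗ (g ⊗ h)) n
      ≡⟨ at (⊗-unfold-head f (g ⊗ h)) n ⟨
    (f ⊗ (g ⊗ h)) n
      ∎
    where open ≡-Reasoning

⊗-commutativeSemigroup : CommutativeSemigroup _ _
⊗-commutativeSemigroup = record
  { Carrier = Series
  ; _≈_ = _≈_
  ; _∙_ = _⊗_
  ; isCommutativeSemigroup = record
    { isSemigroup = record
      { isMagma = record { isEquivalence = Setoid.isEquivalence ≈-setoid ; ∙-cong = ⊗-cong }
      ; assoc = ⊗-assoc
      }
    ; comm = ⊗-comm
    }
  }

module ⊗-Properties = CommutativeSemigroupProperties ⊗-commutativeSemigroup

⊗-z* : ∀ f g → f ⊗ z* g ≈ z* (f ⊗ g)
⊗-z* f g = begin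
  f ⊗ z* g       ≈⟨ ⊗-comm f (z* g) ⟩
  z* g ⊗ f       ≈⟨ z*-⊗ g f ⟩
  z* (g ⊗ f)     ≈⟨ z*-cong (⊗-comm g f) ⟩
  z* (f ⊗ g)     ∎
  where open ≈-Reasoning

prodS-⊗ : ∀ F G m → prodS (λ i → F i ⊗ G i) m ≈ prodS F m ⊗ prodS G m
prodS-⊗ F G zero    = ≈-sym (⊗-identityˡ one)
prodS-⊗ F G (suc m) = begin
  prodS (λ i → F i ⊗ G i) m ⊗ (F (suc m) ⊗ G (suc m))
    ≈⟨ ⊗-congʳ (F (suc m) ⊗ G (suc m)) (prodS-⊗ F G m) ⟩
  (prodS F m ⊗ prodS G m) ⊗ (F (suc m) ⊗ G (suc m))
    ≈⟨ ⊗-Properties.interchange (prodS F m) (prodS G m) (F (suc m)) (G (suc m)) ⟩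
  prodS F (suc m) ⊗ prodS G (suc m)
    ∎
  where open ≈-Reasoning

zpow*-suc : ∀ a f → zpow* (suc a) f ≈ z* (zpow* a f)
zpow*-suc a f = mk≈ (coeff a)
  where
  coeff : ∀ a n → zpow* (suc a) f n ≡ z* (zpow* a f) n
  coeff a       zero    = refl
  coeff zero    (suc n) = refl
  coeff (suc a) (suc n) = refl

zpow*-cong : ∀ a {f g} → f ≈ g → zpow* a f ≈ zpow* a g
zpow*-cong zero    f≈g = f≈g
zpow*-cong (suc a) {f} {g} f≈g = begin
  zpow* (suc a) f    ≈⟨ zpow*-suc a f ⟩
  z* (zpow* a f)     ≈⟨ z*-cong (zpow*-cong a f≈g) ⟩
  z* (zpow* a g)     ≈⟨ zpow*-suc a g ⟨
  zpow* (suc a) g    ∎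
  where open ≈-Reasoning

zpow*-⊕ : ∀ a f g → zpow* a (f ⊕ g) ≈ zpow* a f ⊕ zpow* a g
zpow*-⊕ zero    f g = ≈-refl
zpow*-⊕ (suc a) f g = begin
  zpow* (suc a) (f ⊕ g)                ≈⟨ zpow*-suc a (f ⊕ g) ⟩
  z* (zpow* a (f ⊕ g))                 ≈⟨ z*-cong (zpow*-⊕ a f g) ⟩
  z* (zpow* a f ⊕ zpow* a g)           ≈⟨ z*-⊕ (zpow* a f) (zpow* a g) ⟩
  z* (zpow* a f) ⊕ z* (zpow* a g)      ≈⟨ ⊕-cong (zpow*-suc a f) (zpow*-suc a g) ⟨
  zpow* (suc a) f ⊕ zpow* (suc a) g    ∎
  where open ≈-Reasoning

zpow*-z* : ∀ a f → zpow* a (z* f) ≈ zpow* (suc a) f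
zpow*-z* zero    f = ≈-refl
zpow*-z* (suc a) f = begin
  zpow* (suc a) (z* f)     ≈⟨ zpow*-suc a (z* f) ⟩
  z* (zpow* a (z* f))      ≈⟨ z*-cong (zpow*-z* a f) ⟩
  z* (zpow* (suc a) f)     ≈⟨ zpow*-suc (suc a) f ⟨
  zpow* (suc (suc a)) f    ∎
  where open ≈-Reasoning

zpow*-below : ∀ a f {n} → n < a → zpow* a f n ≡ 0
zpow*-below (suc a) f {zero}  _         = refl
zpow*-below (suc a) f {suc n} (s≤s n<a) = trans (at (zpow*-suc a f) (suc n)) (zpow*-below a f n<a)

invList≡applyUpTo : ∀ f n → invList f n ≡ applyUpTo (λ k → inv1m f (n ∸ k)) (suc n)
invList≡applyUpTo f zero    = refl
invList≡applyUpTo f (suc n) = cong (inv1m f (suc n) ∷_) (invList≡applyUpTo f n)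

sum-zipWith-* : ∀ n (a b : ℕ → ℕ) →
                sum (zipWith _*_ (applyUpTo a n) (applyUpTo b n)) ≡ Σ< n (λ k → a k * b k)
sum-zipWith-* zero    a b = refl
sum-zipWith-* (suc n) a b = cong (a 0 * b 0 +_) (sum-zipWith-* n (λ k → a (suc k)) (λ k → b (suc k)))

inv1m-suc : ∀ f n → inv1m f (suc n) ≡ Σ< (suc n) (λ k → f (suc k) * inv1m f (n ∸ k))
inv1m-suc f n = begin
  sum (zipWith _*_ (map (λ i → f (suc i)) (upTo (suc n))) (invList f n))
    ≡⟨ cong₂ (λ xs ys → sum (zipWith _*_ xs ys))
             (map-upTo (λ i → f (suc i)) (suc n)) (invList≡applyUpTo f n) ⟩
  sum (zipWith _*_ (applyUpTo (λ i → f (suc i)) (suc n)) (applyUpTo (λ k → inv1m f (n ∸ k)) (suc n)))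
    ≡⟨ sum-zipWith-* (suc n) (λ i → f (suc i)) (λ k → inv1m f (n ∸ k)) ⟩
  Σ< (suc n) (λ k → f (suc k) * inv1m f (n ∸ k))
    ∎
  where open ≡-Reasoning

inv1m-fixpoint : ∀ f → inv1m (z* f) ≈ one ⊕ (z* f ⊗ inv1m (z* f))
inv1m-fixpoint f = mk≈ λ where
  zero    → cong suc (sym (⊗-unfold (z* f) (inv1m (z* f)) 0))
  (suc n) → trans (inv1m-suc (z* f) n) (sym (⊗-unfold (z* f) (inv1m (z* f)) (suc n)))

-- Coefficient n of g ⊕ (z* f ⊗ X) involves only the coefficients of X below n.
fixpoint-unique : ∀ f g {X Y} → X ≈ g ⊕ (z* f ⊗ X) → Y ≈ g ⊕ (z* f ⊗ Y) → X ≈ Y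
fixpoint-unique f g {X} {Y} X≈ Y≈ = mk≈ λ n → agree (suc n) ≤-refl
  where
  unfold : ∀ {Z} → Z ≈ g ⊕ (z* f ⊗ Z) → ∀ n → Z n ≡ g n + z* (f ⊗ Z) n
  unfold {Z} Z≈ n = trans (at Z≈ n) (cong (g n +_) (at (z*-⊗ f Z) n))
  agree : ∀ m {k} → k < m → X k ≡ Y k
  agree (suc m) {zero}  _         = trans (unfold X≈ 0) (sym (unfold Y≈ 0))
  agree (suc m) {suc k} (s≤s k<m) = begin
    X (suc k)                ≡⟨ unfold X≈ (suc k) ⟩
    g (suc k) + (f ⊗ X) k    ≡⟨ cong (g (suc k) +_)
                                  (⊗-cong-≤ {f} k (λ _ → refl) (λ i≤k → agree m (≤-<-trans i≤k k<m))) ⟩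
    g (suc k) + (f ⊗ Y) k    ≡⟨ unfold Y≈ (suc k) ⟨
    Y (suc k)                ∎
    where open ≡-Reasoning

inv1m-unique : ∀ f g {X} → X ≈ g ⊕ (z* f ⊗ X) → X ≈ inv1m (z* f) ⊗ g
inv1m-unique f g X≈ = fixpoint-unique f g X≈ (begin
  inv1m (z* f) ⊗ g                          ≈⟨ ⊗-congʳ g (inv1m-fixpoint f) ⟩
  (one ⊕ (z* f ⊗ inv1m (z* f))) ⊗ g         ≈⟨ ⊗-distribʳ-⊕ g one (z* f ⊗ inv1m (z* f)) ⟩
  (one ⊗ g) ⊕ ((z* f ⊗ inv1m (z* f)) ⊗ g)   ≈⟨ ⊕-cong (⊗-identityˡ g) (⊗-assoc (z* f) (inv1m (z* f)) g) ⟩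
  g ⊕ (z* f ⊗ (inv1m (z* f) ⊗ g))           ∎)
  where open ≈-Reasoning

qint-one : qint 1 ≈ one
qint-one = mk≈ λ where
  zero    → refl
  (suc n) → refl

qint-suc : ∀ h → qint (suc h) ≈ one ⊕ z* (qint h)
qint-suc h = mk≈ λ where
  zero    → refl
  (suc n) → refl

z*qint-one-⊗ : ∀ X → z* (qint 1) ⊗ X ≈ z* X
z*qint-one-⊗ X = begin
  z* (qint 1) ⊗ X    ≈⟨ z*-⊗ (qint 1) X ⟩
  z* (qint 1 ⊗ X)    ≈⟨ z*-cong (⊗-congʳ X qint-one) ⟩
  z* (one ⊗ X)       ≈⟨ z*-cong (⊗-identityˡ X) ⟩
  z* X               ∎
  where open ≈-Reasoning

z*qint-suc-⊗ : ∀ h X → z* (qint (suc h)) ⊗ X ≈ z* (X ⊕ (z* (qint h) ⊗ X))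
z*qint-suc-⊗ h X = begin
  z* (qint (suc h)) ⊗ X                ≈⟨ z*-⊗ (qint (suc h)) X ⟩
  z* (qint (suc h) ⊗ X)                ≈⟨ z*-cong (⊗-congʳ X (qint-suc h)) ⟩
  z* ((one ⊕ z* (qint h)) ⊗ X)         ≈⟨ z*-cong (⊗-distribʳ-⊕ X one (z* (qint h))) ⟩
  z* ((one ⊗ X) ⊕ (z* (qint h) ⊗ X))   ≈⟨ z*-cong (⊕-congʳ (z* (qint h) ⊗ X) (⊗-identityˡ X)) ⟩
  z* (X ⊕ (z* (qint h) ⊗ X))           ∎
  where open ≈-Reasoning

≤ᵇ-true : ∀ {m n} → m ≤ n → (m ≤ᵇ n) ≡ true
≤ᵇ-true m≤n = Equivalence.to T-≡ (≤⇒≤ᵇ m≤n)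

≤ᵇ-false : ∀ {m n} → n < m → (m ≤ᵇ n) ≡ false
≤ᵇ-false {m} {n} n<m with m ≤ᵇ n in m≤ᵇn
... | false = refl
... | true  = contradiction (≤ᵇ⇒≤ m n (Equivalence.from T-≡ m≤ᵇn)) (<⇒≱ n<m)

≤ᵇ-flip : ∀ {m n} → (m ≤ᵇ n) ≡ false → (n ≤ᵇ m) ≡ true
≤ᵇ-flip {m} {n} m≰ᵇn with ≤-total m n
... | inj₁ m≤n = contradiction (trans (sym (≤ᵇ-true m≤n)) m≰ᵇn) λ ()
... | inj₂ n≤m = ≤ᵇ-true n≤m

data Phase : Set where
  rising falling : Phase

admissible : Phase → ℕ → List ℕ → Bool
admissible rising  p []       = true
admissible rising  p (x ∷ xs) = if p ≤ᵇ x then admissible rising x xs else admissible falling x xs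
admissible falling p xs       = noninc (p ∷ xs)

admissible-[] : ∀ φ p → admissible φ p [] ≡ true
admissible-[] rising  p = refl
admissible-[] falling p = refl

falling⇒rising : ∀ p xs → admissible falling p xs ≡ true → admissible rising p xs ≡ true
falling⇒rising p []       _        = refl
falling⇒rising p (x ∷ xs) noninc≡true with x ≤ᵇ p | p ≤ᵇ x
... | true | true  = falling⇒rising x xs noninc≡true
... | true | false = noninc≡true

or-applyUpTo-false : ∀ n → or (applyUpTo (λ _ → false) n) ≡ false
or-applyUpTo-false zero    = refl
or-applyUpTo-false (suc n) = or-applyUpTo-false n

or-applyUpTo-∧ : ∀ b (P Q : ℕ → Bool) n →
                 or (applyUpTo (λ i → (b ∧ P i) ∧ Q i) n) ≡ b ∧ or (applyUpTo (λ i → P i ∧ Q i) n)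
or-applyUpTo-∧ true  P Q n = refl
or-applyUpTo-∧ false P Q n = or-applyUpTo-false n

unimodalSplit : ℕ → List ℕ → Bool
unimodalSplit x ys =
  or (applyUpTo (λ i → nondec (take (suc i) (x ∷ ys)) ∧ noninc (drop i (x ∷ ys))) (suc (length ys)))

unimodalSplit≡admissible : ∀ x ys → unimodalSplit x ys ≡ admissible rising x ys
unimodalSplit≡admissible x []       = refl
unimodalSplit≡admissible x (y ∷ zs) = begin
  noninc (x ∷ y ∷ zs) ∨ or (applyUpTo (λ i → ((x ≤ᵇ y) ∧ P i) ∧ Q i) (suc (length zs)))
    ≡⟨ cong (noninc (x ∷ y ∷ zs) ∨_) (or-applyUpTo-∧ (x ≤ᵇ y) P Q (suc (length zs))) ⟩
  noninc (x ∷ y ∷ zs) ∨ ((x ≤ᵇ y) ∧ unimodalSplit y zs)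
    ≡⟨ cong (λ b → noninc (x ∷ y ∷ zs) ∨ ((x ≤ᵇ y) ∧ b)) (unimodalSplit≡admissible y zs) ⟩
  ((y ≤ᵇ x) ∧ noninc (y ∷ zs)) ∨ ((x ≤ᵇ y) ∧ admissible rising y zs)
    ≡⟨ choose (x ≤ᵇ y) refl ⟩
  admissible rising x (y ∷ zs)
    ∎
  where
  open ≡-Reasoning
  P Q : ℕ → Bool
  P i = nondec (take (suc i) (y ∷ zs))
  Q i = noninc (drop i (y ∷ zs))
  choose : ∀ b → (x ≤ᵇ y) ≡ b →
           ((y ≤ᵇ x) ∧ noninc (y ∷ zs)) ∨ (b ∧ admissible rising y zs)
             ≡ (if b then admissible rising y zs else noninc (y ∷ zs))
  choose true  _ with y ≤ᵇ x
  ... | false = refl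
  ... | true with noninc (y ∷ zs) in noninc≡true
  ...   | false = refl
  ...   | true  = sym (falling⇒rising y zs noninc≡true)
  choose false x≰ᵇy =
    trans (cong (λ b → (b ∧ noninc (y ∷ zs)) ∨ false) (≤ᵇ-flip {x} {y} x≰ᵇy))
          (∨-identityʳ (noninc (y ∷ zs)))

weaklyUnimodal≡admissible : ∀ xs → weaklyUnimodal xs ≡ admissible rising 0 xs
weaklyUnimodal≡admissible []       = refl
weaklyUnimodal≡admissible (x ∷ xs) =
  trans (cong or (map-upTo _ (suc (length xs)))) (unimodalSplit≡admissible x xs)

-- down φ h p: at height h after a down step (or at the start); up φ h p: at height suc h after an
-- up step. In both, p is the height of the previous peak and φ the phase of the peak sequence.
data State : Set where
  down up : Phase → ℕ → ℕ → State
  dead    : State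

afterPeak : Phase → ℕ → ℕ → State
afterPeak rising  h p = if p ≤ᵇ suc h then down rising h (suc h) else down falling h (suc h)
afterPeak falling h p = if suc h ≤ᵇ p then down falling h (suc h) else dead

δ : State → Step → State
δ (down φ h       p) u = up φ h p
δ (down φ zero    p) d = dead
δ (down φ (suc h) p) d = down φ h p
δ (up φ h p)         u = up φ (suc h) p
δ (up φ h p)         d = afterPeak φ h p
δ dead               _ = dead

final : State → Bool
final (down _ zero _) = true
final _               = false

accepts : State → List Step → Bool
accepts s []      = final s
accepts s (x ∷ w) = accepts (δ s x) w

accepts-dead : ∀ w → accepts dead w ≡ false
accepts-dead []      = refl
accepts-dead (_ ∷ w) = accepts-dead w

accepts-down : ∀ φ h p w → accepts (down φ h p) w ≡ isDyckFrom h w ∧ admissible φ p (peaksFrom h w)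
accepts-up : ∀ φ h p w → accepts (up φ h p) w ≡ isDyckFrom (suc h) w ∧ admissible φ p (peaksFrom h (u ∷ w))
accepts-afterPeak : ∀ φ h p w →
                    accepts (afterPeak φ h p) w ≡ isDyckFrom h w ∧ admissible φ p (suc h ∷ peaksFrom h w)

accepts-down φ zero    p []      = sym (admissible-[] φ p)
accepts-down φ (suc h) p []      = refl
accepts-down φ zero    p (u ∷ w) = accepts-up φ zero p w
accepts-down φ (suc h) p (u ∷ w) = accepts-up φ (suc h) p w
accepts-down φ zero    p (d ∷ w) = accepts-dead w
accepts-down φ (suc h) p (d ∷ w) = accepts-down φ h p w

accepts-up φ h p []      = refl
accepts-up φ h p (u ∷ w) = accepts-up φ (suc h) p w
accepts-up φ h p (d ∷ w) = accepts-afterPeak φ h p w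

accepts-afterPeak rising h p w with p ≤ᵇ suc h
... | true  = accepts-down rising h (suc h) w
... | false = accepts-down falling h (suc h) w
accepts-afterPeak falling h p w with suc h ≤ᵇ p
... | true  = accepts-down falling h (suc h) w
... | false = trans (accepts-dead w) (sym (∧-zeroʳ (isDyckFrom h w)))

accepts-start : ∀ w → (isDyck w ∧ weaklyUnimodal (peakHeights w)) ≡ accepts (down rising 0 0) w
accepts-start w =
  trans (cong (isDyck w ∧_) (weaklyUnimodal≡admissible (peakHeights w))) (sym (accepts-down rising 0 0 w))

afterPeak-rising-≤ : ∀ {h p} → p ≤ suc h → afterPeak rising h p ≡ down rising h (suc h)
afterPeak-rising-≤ {h} p≤1+h =
  cong (λ b → if b then down rising h (suc h) else down falling h (suc h)) (≤ᵇ-true p≤1+h)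

afterPeak-falling-≤ : ∀ {h p} → suc h ≤ p → afterPeak falling h p ≡ down falling h (suc h)
afterPeak-falling-≤ {h} 1+h≤p = cong (λ b → if b then down falling h (suc h) else dead) (≤ᵇ-true 1+h≤p)

afterPeak-falling-> : ∀ {h p} → p ≤ h → afterPeak falling h p ≡ dead
afterPeak-falling-> {h} p≤h = cong (λ b → if b then down falling h (suc h) else dead) (≤ᵇ-false (s≤s p≤h))

afterPeak-< : ∀ φ {h p} → suc h < p → afterPeak φ h p ≡ down falling h (suc h)
afterPeak-< rising  {h} 1+h<p =
  cong (λ b → if b then down rising h (suc h) else down falling h (suc h)) (≤ᵇ-false 1+h<p)
afterPeak-< falling     1+h<p = afterPeak-falling-≤ (<⇒≤ 1+h<p)

-- The next peak has height at least suc h ≥ p, so the comparison with p always succeeds.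
accepts-up-rising : ∀ {h p} → p ≤ suc h → ∀ w → accepts (up rising h p) w ≡ accepts (up rising h 0) w
accepts-up-rising p≤1+h []      = refl
accepts-up-rising p≤1+h (u ∷ w) = accepts-up-rising (m≤n⇒m≤1+n p≤1+h) w
accepts-up-rising p≤1+h (d ∷ w) = cong (λ s → accepts s w) (afterPeak-rising-≤ p≤1+h)

accepts-up-falling-> : ∀ {h p} → p ≤ h → ∀ w → accepts (up falling h p) w ≡ false
accepts-up-falling-> p≤h []      = refl
accepts-up-falling-> p≤h (u ∷ w) = accepts-up-falling-> (m≤n⇒m≤1+n p≤h) w
accepts-up-falling-> p≤h (d ∷ w) = trans (cong (λ s → accepts s w) (afterPeak-falling-> p≤h)) (accepts-dead w)

count : (List Step → Bool) → List (List Step) → ℕ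
count P ws = length (filter (λ w → T? (P w)) ws)

indicator : Bool → ℕ
indicator true  = 1
indicator false = 0

count-∷ : ∀ P w ws → count P (w ∷ ws) ≡ indicator (P w) + count P ws
count-∷ P w ws with P w
... | true  = refl
... | false = refl

count-cong : ∀ {P Q} → (∀ w → P w ≡ Q w) → ∀ ws → count P ws ≡ count Q ws
count-cong P≡Q []       = refl
count-cong {P} {Q} P≡Q (w ∷ ws) = begin
  count P (w ∷ ws)                ≡⟨ count-∷ P w ws ⟩
  indicator (P w) + count P ws    ≡⟨ cong₂ _+_ (cong indicator (P≡Q w)) (count-cong P≡Q ws) ⟩
  indicator (Q w) + count Q ws    ≡⟨ count-∷ Q w ws ⟨
  count Q (w ∷ ws)                ∎
  where open ≡-Reasoning

count-false : ∀ ws → count (λ _ → false) ws ≡ 0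
count-false []       = refl
count-false (_ ∷ ws) = count-false ws

count-prepend : ∀ P ws → count P (concatMap (λ w → (u ∷ w) ∷ (d ∷ w) ∷ []) ws)
                         ≡ count (λ w → P (u ∷ w)) ws + count (λ w → P (d ∷ w)) ws
count-prepend P []       = refl
count-prepend P (w ∷ ws) = begin
  count P ((u ∷ w) ∷ (d ∷ w) ∷ concatMap (λ w → (u ∷ w) ∷ (d ∷ w) ∷ []) ws)
    ≡⟨ trans (count-∷ P (u ∷ w) _) (cong (a +_) (count-∷ P (d ∷ w) _)) ⟩
  a + (b + count P (concatMap (λ w → (u ∷ w) ∷ (d ∷ w) ∷ []) ws))
    ≡⟨ +-assoc a b _ ⟨
  (a + b) + count P (concatMap (λ w → (u ∷ w) ∷ (d ∷ w) ∷ []) ws)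
    ≡⟨ cong ((a + b) +_) (count-prepend P ws) ⟩
  (a + b) + (count Pu ws + count Pd ws)
    ≡⟨ +-Properties.interchange a b (count Pu ws) (count Pd ws) ⟩
  (a + count Pu ws) + (b + count Pd ws)
    ≡⟨ cong₂ _+_ (count-∷ Pu w ws) (count-∷ Pd w ws) ⟨
  count Pu (w ∷ ws) + count Pd (w ∷ ws)
    ∎
  where
  open ≡-Reasoning
  Pu Pd : List Step → Bool
  Pu w = P (u ∷ w)
  Pd w = P (d ∷ w)
  a = indicator (Pu w)
  b = indicator (Pd w)

accepted : State → ℕ → ℕ
accepted s m = count (accepts s) (words m)

accepted-suc : ∀ s m → accepted s (suc m) ≡ accepted (δ s u) m + accepted (δ s d) m
accepted-suc s m = count-prepend (accepts s) (words m)

accepted-dead : ∀ m → accepted dead m ≡ 0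
accepted-dead m = trans (count-cong accepts-dead (words m)) (count-false (words m))

height : State → ℕ
height (down _ h _) = h
height (up _ h _)   = suc h
height dead         = 0

accepted-short : ∀ s {m} → m < height s → accepted s m ≡ 0
accepted-short-afterPeak : ∀ φ h p {m} → m < h → accepted (afterPeak φ h p) m ≡ 0

accepted-short (down φ (suc h) p) {zero}  _         = refl
accepted-short (up φ h p)         {zero}  _         = refl
accepted-short (down φ (suc h) p) {suc m} (s≤s m<h) = trans (accepted-suc (down φ (suc h) p) m)
  (cong₂ _+_ (accepted-short (up φ (suc h) p) (m<n⇒m<1+n (m<n⇒m<1+n m<h))) (accepted-short (down φ h p) m<h))
accepted-short (up φ h p)         {suc m} (s≤s m<h) = trans (accepted-suc (up φ h p) m)
  (cong₂ _+_ (accepted-short (up φ (suc h) p) (m<n⇒m<1+n (m<n⇒m<1+n m<h))) (accepted-short-afterPeak φ h p m<h))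

accepted-short-afterPeak rising h p m<h with p ≤ᵇ suc h
... | true  = accepted-short (down rising h (suc h)) m<h
... | false = accepted-short (down falling h (suc h)) m<h
accepted-short-afterPeak falling h p {m} m<h with suc h ≤ᵇ p
... | true  = accepted-short (down falling h (suc h)) m<h
... | false = accepted-dead m

-- The words accepted from s have length 2n + height s, n being the number of up steps.
gf : State → Series
gf s n = accepted s (n + n + height s)

gf-step : ∀ s k → height s ≡ suc k → height (δ s u) ≡ suc (suc k) →
          gf s ≈ (λ n → accepted (δ s d) (n + n + k)) ⊕ z* (gf (δ s u))
gf-step s k hs hu = mk≈ λ n → begin
  accepted s (n + n + height s)
    ≡⟨ cong (λ h → accepted s (n + n + h)) hs ⟩
  accepted s (n + n + suc k)
    ≡⟨ cong (accepted s) (+-suc (n + n) k) ⟩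
  accepted s (suc (n + n + k))
    ≡⟨ accepted-suc s (n + n + k) ⟩
  accepted (δ s u) (n + n + k) + accepted (δ s d) (n + n + k)
    ≡⟨ +-comm (accepted (δ s u) (n + n + k)) _ ⟩
  accepted (δ s d) (n + n + k) + accepted (δ s u) (n + n + k)
    ≡⟨ cong (accepted (δ s d) (n + n + k) +_) (afterUp n) ⟩
  accepted (δ s d) (n + n + k) + z* (gf (δ s u)) n
    ∎
  where
  open ≡-Reasoning
  shift : ∀ n k → suc n + suc n + k ≡ n + n + suc (suc k)
  shift = solve-∀
  afterUp : ∀ n → accepted (δ s u) (n + n + k) ≡ z* (gf (δ s u)) n
  afterUp zero    = accepted-short (δ s u) (subst (k <_) (sym hu) (m<n⇒m<1+n (n<1+n k)))
  afterUp (suc n) = cong (accepted (δ s u)) (trans (shift n k) (cong (λ h → n + n + h) (sym hu)))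

gf-down-zero : ∀ φ p → gf (down φ 0 p) ≈ one ⊕ z* (gf (up φ 0 p))
gf-down-zero φ p = mk≈ coeff
  where
  open ≡-Reasoning
  shift : ∀ n → n + suc n + 0 ≡ n + n + 1
  shift = solve-∀
  coeff : ∀ n → gf (down φ 0 p) n ≡ (one ⊕ z* (gf (up φ 0 p))) n
  coeff zero    = refl
  coeff (suc n) = begin
    accepted (down φ 0 p) (suc (n + suc n + 0))
      ≡⟨ accepted-suc (down φ 0 p) (n + suc n + 0) ⟩
    accepted (up φ 0 p) (n + suc n + 0) + accepted dead (n + suc n + 0)
      ≡⟨ cong₂ _+_ (cong (accepted (up φ 0 p)) (shift n)) (accepted-dead (n + suc n + 0)) ⟩
    accepted (up φ 0 p) (n + n + 1) + 0
      ≡⟨ +-identityʳ _ ⟩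
    gf (up φ 0 p) n
      ∎

gf-down-suc : ∀ φ h p → gf (down φ (suc h) p) ≈ gf (down φ h p) ⊕ z* (gf (up φ (suc h) p))
gf-down-suc φ h p = gf-step (down φ (suc h) p) h refl refl

gf-up : ∀ φ h p → gf (up φ h p) ≈ (λ n → accepted (afterPeak φ h p) (n + n + h)) ⊕ z* (gf (up φ (suc h) p))
gf-up φ h p = gf-step (up φ h p) h refl refl

gf-up-afterPeak : ∀ φ ψ {h p} → afterPeak φ h p ≡ down ψ h (suc h) →
                  gf (up φ h p) ≈ gf (down ψ h (suc h)) ⊕ z* (gf (up φ (suc h) p))
gf-up-afterPeak φ ψ {h} {p} afterPeak≡ = ≈-trans (gf-up φ h p)
  (⊕-congʳ (z* (gf (up φ (suc h) p))) (mk≈ λ n → cong (λ s → accepted s (n + n + h)) afterPeak≡))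

gf-up-falling-> : ∀ {h p} → p ≤ h → gf (up falling h p) ≈ zeroS
gf-up-falling-> {h} p≤h = mk≈ λ n →
  trans (count-cong (accepts-up-falling-> p≤h) (words (n + n + suc h))) (count-false (words (n + n + suc h)))

gf-up-rising : ∀ {h p} → p ≤ suc h → gf (up rising h p) ≈ gf (up rising h 0)
gf-up-rising {h} p≤1+h = mk≈ λ n → count-cong (accepts-up-rising p≤1+h) (words (n + n + suc h))

-- Either the next peak is at most q, and from then on the peaks fall, or the path first climbs to suc q.
gf-up-raise : ∀ φ e j q → e + j ≡ q →
              gf (up φ j (suc q)) ≈ gf (up falling j q) ⊕ zpow* e (gf (up φ q (suc q)))
gf-up-raise φ zero    j .j refl = ≈-sym (≈-trans (⊕-comm (gf (up falling j j)) (gf (up φ j (suc j))))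
                                          (⊕-vanishʳ (gf (up φ j (suc j))) (gf-up-falling-> ≤-refl)))
gf-up-raise φ (suc e) j q 1+e+j≡q = begin
  gf (up φ j (suc q))
    ≈⟨ gf-up-afterPeak φ falling (afterPeak-< φ (s≤s j<q)) ⟩
  D ⊕ z* (gf (up φ (suc j) (suc q)))
    ≈⟨ ⊕-congˡ D (z*-cong (gf-up-raise φ e (suc j) q (trans (+-suc e j) 1+e+j≡q))) ⟩
  D ⊕ z* (gf (up falling (suc j) q) ⊕ zpow* e X)
    ≈⟨ ⊕-congˡ D (z*-⊕ (gf (up falling (suc j) q)) (zpow* e X)) ⟩
  D ⊕ (z* (gf (up falling (suc j) q)) ⊕ z* (zpow* e X))
    ≈⟨ ⊕-assoc D (z* (gf (up falling (suc j) q))) (z* (zpow* e X)) ⟨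
  (D ⊕ z* (gf (up falling (suc j) q))) ⊕ z* (zpow* e X)
    ≈⟨ ⊕-cong (gf-up-afterPeak falling falling (afterPeak-falling-≤ j<q)) (zpow*-suc e X) ⟨
  gf (up falling j q) ⊕ zpow* (suc e) X
    ∎
  where
  open ≈-Reasoning
  D = gf (down falling j (suc j))
  X = gf (up φ q (suc q))
  j<q : j < q
  j<q = subst (j <_) 1+e+j≡q (s≤s (m≤n+m j e))

gf-down-raise : ∀ φ q h e → e + h ≡ q →
                gf (down φ h (suc q)) ≈ gf (down falling h q) ⊕ zpow* e (z* (qint (suc h)) ⊗ gf (up φ q (suc q)))
gf-down-raise φ q zero e e+0≡q = begin
  gf (down φ 0 (suc q))
    ≈⟨ gf-down-zero φ (suc q) ⟩
  one ⊕ z* (gf (up φ 0 (suc q)))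
    ≈⟨ ⊕-congˡ one (z*-cong (gf-up-raise φ e 0 q e+0≡q)) ⟩
  one ⊕ z* (gf (up falling 0 q) ⊕ zpow* e X)
    ≈⟨ ⊕-congˡ one (z*-⊕ (gf (up falling 0 q)) (zpow* e X)) ⟩
  one ⊕ (z* (gf (up falling 0 q)) ⊕ z* (zpow* e X))
    ≈⟨ ⊕-assoc one (z* (gf (up falling 0 q))) (z* (zpow* e X)) ⟨
  (one ⊕ z* (gf (up falling 0 q))) ⊕ z* (zpow* e X)
    ≈⟨ ⊕-cong (gf-down-zero falling q) shift ⟨
  gf (down falling 0 q) ⊕ zpow* e (z* (qint 1) ⊗ X)
    ∎
  where
  open ≈-Reasoning
  X = gf (up φ q (suc q))
  shift : zpow* e (z* (qint 1) ⊗ X) ≈ z* (zpow* e X)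
  shift = begin
    zpow* e (z* (qint 1) ⊗ X)   ≈⟨ zpow*-cong e (z*qint-one-⊗ X) ⟩
    zpow* e (z* X)              ≈⟨ zpow*-z* e X ⟩
    zpow* (suc e) X             ≈⟨ zpow*-suc e X ⟩
    z* (zpow* e X)              ∎
gf-down-raise φ q (suc h) e e+1+h≡q = begin
  gf (down φ (suc h) (suc q))
    ≈⟨ gf-down-suc φ h (suc q) ⟩
  gf (down φ h (suc q)) ⊕ z* (gf (up φ (suc h) (suc q)))
    ≈⟨ ⊕-cong (gf-down-raise φ q h (suc e) (trans (sym (+-suc e h)) e+1+h≡q))
              (z*-cong (gf-up-raise φ e (suc h) q e+1+h≡q)) ⟩
  (D ⊕ zpow* (suc e) Y) ⊕ z* (U ⊕ zpow* e X)
    ≈⟨ ⊕-congˡ (D ⊕ zpow* (suc e) Y) (z*-⊕ U (zpow* e X)) ⟩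
  (D ⊕ zpow* (suc e) Y) ⊕ (z* U ⊕ z* (zpow* e X))
    ≈⟨ ⊕-Properties.interchange D (zpow* (suc e) Y) (z* U) (z* (zpow* e X)) ⟩
  (D ⊕ z* U) ⊕ (zpow* (suc e) Y ⊕ z* (zpow* e X))
    ≈⟨ ⊕-cong (gf-down-suc falling h q) shift ⟨
  gf (down falling (suc h) q) ⊕ zpow* e (z* (qint (suc (suc h))) ⊗ X)
    ∎
  where
  open ≈-Reasoning
  D = gf (down falling h q)
  U = gf (up falling (suc h) q)
  X = gf (up φ q (suc q))
  Y = z* (qint (suc h)) ⊗ X
  shift : zpow* e (z* (qint (suc (suc h))) ⊗ X) ≈ zpow* (suc e) Y ⊕ z* (zpow* e X)
  shift = begin
    zpow* e (z* (qint (suc (suc h))) ⊗ X)   ≈⟨ zpow*-cong e (z*qint-suc-⊗ (suc h) X) ⟩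
    zpow* e (z* (X ⊕ Y))                    ≈⟨ zpow*-z* e (X ⊕ Y) ⟩
    zpow* (suc e) (X ⊕ Y)                   ≈⟨ zpow*-cong (suc e) (⊕-comm X Y) ⟩
    zpow* (suc e) (Y ⊕ X)                   ≈⟨ zpow*-⊕ (suc e) Y X ⟩
    zpow* (suc e) Y ⊕ zpow* (suc e) X       ≈⟨ ⊕-congˡ (zpow* (suc e) Y) (zpow*-suc e X) ⟩
    zpow* (suc e) Y ⊕ z* (zpow* e X)        ∎

T K : ℕ → Series
T q = gf (down falling q q)
K q = gf (up rising q 0)

invQ : ℕ → Series
invQ i = inv1m (z* (qint i))

invProd : ℕ → Series
invProd = prodS invQ

T-zero : T 0 ≈ one
T-zero = ≈-trans (gf-down-zero falling 0) (⊕-vanishʳ one (z*-zero (gf-up-falling-> ≤-refl)))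

T-suc : ∀ q → T (suc q) ≈ gf (down falling q (suc q))
T-suc q = ≈-trans (gf-down-suc falling q (suc q)) (⊕-vanishʳ _ (z*-zero (gf-up-falling-> ≤-refl)))

T-fixpoint : ∀ q → T (suc q) ≈ T q ⊕ (z* (qint (suc q)) ⊗ T (suc q))
T-fixpoint q = begin
  T (suc q)
    ≈⟨ T-suc q ⟩
  gf (down falling q (suc q))
    ≈⟨ gf-down-raise falling q q 0 refl ⟩
  T q ⊕ (z* (qint (suc q)) ⊗ gf (up falling q (suc q)))
    ≈⟨ ⊕-congˡ (T q) (⊗-congˡ (z* (qint (suc q))) peak) ⟩
  T q ⊕ (z* (qint (suc q)) ⊗ T (suc q))
    ∎
  where
  open ≈-Reasoning
  peak : gf (up falling q (suc q)) ≈ T (suc q)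
  peak = begin
    gf (up falling q (suc q))
      ≈⟨ gf-up-afterPeak falling falling (afterPeak-falling-≤ ≤-refl) ⟩
    gf (down falling q (suc q)) ⊕ z* (gf (up falling (suc q) (suc q)))
      ≈⟨ ⊕-vanishʳ _ (z*-zero (gf-up-falling-> ≤-refl)) ⟩
    gf (down falling q (suc q))
      ≈⟨ T-suc q ⟨
    T (suc q)
      ∎

T≈invProd : ∀ q → T q ≈ invProd q
T≈invProd zero    = T-zero
T≈invProd (suc q) = begin
  T (suc q)                ≈⟨ inv1m-unique (qint (suc q)) (T q) (T-fixpoint q) ⟩
  invQ (suc q) ⊗ T q       ≈⟨ ⊗-congˡ (invQ (suc q)) (T≈invProd q) ⟩
  invQ (suc q) ⊗ invProd q ≈⟨ ⊗-comm (invQ (suc q)) (invProd q) ⟩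
  invProd (suc q)          ∎
  where open ≈-Reasoning

K-fixpoint : ∀ q → K q ≈ (T q ⊕ z* (K (suc q))) ⊕ (z* (qint (suc q)) ⊗ K q)
K-fixpoint q = begin
  K q
    ≈⟨ gf-up rising q 0 ⟩
  gf (down rising q (suc q)) ⊕ z* (K (suc q))
    ≈⟨ ⊕-congʳ (z* (K (suc q))) (gf-down-raise rising q q 0 refl) ⟩
  (T q ⊕ (z* (qint (suc q)) ⊗ gf (up rising q (suc q)))) ⊕ z* (K (suc q))
    ≈⟨ ⊕-congʳ (z* (K (suc q))) (⊕-congˡ (T q) (⊗-congˡ (z* (qint (suc q))) (gf-up-rising ≤-refl))) ⟩
  (T q ⊕ (z* (qint (suc q)) ⊗ K q)) ⊕ z* (K (suc q))
    ≈⟨ ⊕-Properties.xy∙z≈xz∙y (T q) (z* (qint (suc q)) ⊗ K q) (z* (K (suc q))) ⟩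
  (T q ⊕ z* (K (suc q))) ⊕ (z* (qint (suc q)) ⊗ K q)
    ∎
  where open ≈-Reasoning

K-solve : ∀ q → K q ≈ invQ (suc q) ⊗ (invProd q ⊕ z* (K (suc q)))
K-solve q = ≈-trans (inv1m-unique (qint (suc q)) (T q ⊕ z* (K (suc q))) (K-fixpoint q))
  (⊗-congˡ (invQ (suc q)) (⊕-congʳ (z* (K (suc q))) (T≈invProd q)))

remainder : ℕ → Series
remainder B = zpow* (suc B) (invProd B ⊗ K B)

remainder-suc : ∀ B → remainder B ≈ term (suc B) ⊕ remainder (suc B)
remainder-suc B = begin
  zpow* (suc B) (P ⊗ K B)
    ≈⟨ zpow*-cong (suc B) split ⟩
  zpow* (suc B) (summand ⊕ z* (P′ ⊗ K′))
    ≈⟨ zpow*-⊕ (suc B) summand (z* (P′ ⊗ K′)) ⟩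
  term (suc B) ⊕ zpow* (suc B) (z* (P′ ⊗ K′))
    ≈⟨ ⊕-congˡ (term (suc B)) (zpow*-z* (suc B) (P′ ⊗ K′)) ⟩
  term (suc B) ⊕ remainder (suc B)
    ∎
  where
  open ≈-Reasoning
  P P′ K′ I summand : Series
  P = invProd B
  P′ = invProd (suc B)
  K′ = K (suc B)
  I = invQ (suc B)
  summand = I ⊗ prodS (λ i → invQ i ⊗ invQ i) B
  split : P ⊗ K B ≈ summand ⊕ z* (P′ ⊗ K′)
  split = begin
    P ⊗ K B
      ≈⟨ ⊗-congˡ P (K-solve B) ⟩
    P ⊗ (I ⊗ (P ⊕ z* K′))
      ≈⟨ ⊗-assoc P I (P ⊕ z* K′) ⟨
    P′ ⊗ (P ⊕ z* K′)
      ≈⟨ ⊗-distribˡ-⊕ P′ P (z* K′) ⟩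
    (P′ ⊗ P) ⊕ (P′ ⊗ z* K′)
      ≈⟨ ⊕-cong (⊗-Properties.xy∙z≈y∙xz P I P) (⊗-z* P′ K′) ⟩
    (I ⊗ (P ⊗ P)) ⊕ z* (P′ ⊗ K′)
      ≈⟨ ⊕-congʳ (z* (P′ ⊗ K′)) (⊗-congˡ I (prodS-⊗ invQ invQ B)) ⟨
    summand ⊕ z* (P′ ⊗ K′)
      ∎

telescope : ∀ B → one ⊕ z* (K 0) ≈ rhsPartial B ⊕ remainder B
telescope zero    = ⊕-congˡ one (z*-cong (≈-sym (⊗-identityˡ (K 0))))
telescope (suc B) = begin
  one ⊕ z* (K 0)
    ≈⟨ telescope B ⟩
  rhsPartial B ⊕ remainder B
    ≈⟨ ⊕-congˡ (rhsPartial B) (remainder-suc B) ⟩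
  rhsPartial B ⊕ (term (suc B) ⊕ remainder (suc B))
    ≈⟨ ⊕-assoc (rhsPartial B) (term (suc B)) (remainder (suc B)) ⟨
  rhsPartial (suc B) ⊕ remainder (suc B)
    ∎
  where open ≈-Reasoning

countM≡gf : ∀ n → countM n ≡ gf (down rising 0 0) n
countM≡gf n = trans (count-cong accepts-start (words (2 * n))) (cong (accepted (down rising 0 0)) (double n))
  where
  double : ∀ n → 2 * n ≡ n + n + 0
  double = solve-∀

mainTheorem17 : (n N : ℕ) → n ≤ N → countM n ≡ rhsPartial N n
mainTheorem17 n N n≤N = begin
  countM n                         ≡⟨ countM≡gf n ⟩
  gf (down rising 0 0) n           ≡⟨ at (gf-down-zero rising 0) n ⟩
  (one ⊕ z* (K 0)) n               ≡⟨ at (telescope N) n ⟩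
  rhsPartial N n + remainder N n   ≡⟨ cong (rhsPartial N n +_) (zpow*-below (suc N) (invProd N ⊗ K N) (s≤s n≤N)) ⟩
  rhsPartial N n + 0               ≡⟨ +-identityʳ (rhsPartial N n) ⟩
  rhsPartial N n                   ∎
  where open ≡-Reasoning
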